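{- Let $\delta,k$ be positive integers with $k\leq\delta$ and let $f(k,\delta)=(k+\delta k)\sum_{j=0}^{k-1}\binom{\delta}{j}+1$. Let $G$ be a graph with maximum degree $\delta$ and let $Y=\{K_1,\dots,K_t\}$ be a set of cliques of $G$, each of size at most $k$. Then there exists a partition $(Y_1,\dots,Y_{f(k,\delta)})$ of $Y$ such that for every $\ell\in\{1,\dots,f(k,\delta)\}$ and all distinct $K_i,K_j\in Y_\ell$, $K_i$ is anticomplete to $K_j$.
   Context: Two sets $X,Y$ of vertices are anticomplete to each other if they are disjoint and there are no edges between them. Parts of the partition are allowed to be empty. -}

module Defs where

open import Data.Nat using (ℕ; _+_; _*_; _≤_)
open import Data.Nat.Combinatorics using (_C_)
open import Data.Bool using (Bool; true; false; if_then_else_)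
open import Data.Fin using (Fin)
open import Data.Fin.Subset using (Subset; _∈_; ∣_∣)
open import Data.List using (map; upTo; allFin)
open import Data.Nat.ListAction using (sum)
open import Data.Product using (_×_; ∃)
open import Relation.Binary.PropositionalEquality using (_≡_; _≢_)

record Graph : Set where
  field
    n      : ℕ
    adj    : Fin n → Fin n → Bool
    sym    : ∀ u v → adj u v ≡ adj v u
    irrefl : ∀ u → adj u u ≡ false

open Graph public

degree : (G : Graph) → Fin (n G) → ℕ
degree G u = sum (map (λ v → if adj G u v then 1 else 0) (allFin (n G)))

MaxDegree : Graph → ℕ → Set
MaxDegree G δ = (∀ u → degree G u ≤ δ) × ∃ λ u → degree G u ≡ δ

IsClique : (G : Graph) → Subset (n G) → Set
IsClique G K = ∀ u v → u ∈ K → v ∈ K → u ≢ v → adj G u v ≡ true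

Anticomplete : (G : Graph) → Subset (n G) → Subset (n G) → Set
Anticomplete G X Y = ∀ u v → u ∈ X → v ∈ Y → (u ≢ v) × (adj G u v ≡ false)

f : ℕ → ℕ → ℕ
f k δ = (k + δ * k) * sum (map (δ C_) (upTo k)) + 1

-- A vertex w lies in at most Σ_{j<k} C(δ,j) of the cliques: removing w sends the cliques
-- through w injectively to subsets of N(w) with fewer than k elements.  A clique that is not
-- anticomplete to K_i contains a vertex of the closed neighbourhood of K_i, which has at most
-- k + δk vertices; so each clique conflicts with fewer than f(k,δ) cliques, and a greedy
-- colouring of the conflict graph with f(k,δ) colours is the required partition.
module Submission where

open import Defs
open import Data.Nat using (ℕ; _≤_; _<_)
open import Data.Fin using (Fin)
open import Data.Fin.Subset using (Subset; ∣_∣)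
open import Data.Product using (Σ; _×_)
open import Function.Definitions using (Injective)
open import Relation.Binary.PropositionalEquality using (_≡_; _≢_)

open import Data.Nat using (zero; suc; _+_; _*_; z≤n; s≤s; z<s; _≤′_; ≤′-refl; ≤′-step)
open import Data.Nat.Properties
  using ( ≤-refl; ≤-trans; <-≤-trans; ≤-<-trans; m≤n⇒m≤1+n; <⇒≱; m≤m+n; m<m+n
        ; +-mono-≤; +-identityʳ; *-monoˡ-≤; *-suc; *-comm; ≤⇒≤′; module ≤-Reasoning)
open import Data.Nat.Combinatorics using (_C_; nCk+nC[k+1]≡[n+1]C[k+1])
open import Data.Nat.ListAction using (sum)
open import Data.Nat.ListAction.Properties using (sum-++)
open import Data.Nat.Solver using (module +-*-Solver)
open import Data.Bool using (Bool; true; false; if_then_else_)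
open import Data.Fin using (zero; suc; _≟_)
open import Data.Fin.Properties using (injective⇒≤; ¬∀⟶∃¬; suc-injective)
open import Data.Fin.Subset using (inside; outside; _∈_; _∉_; _⊆_; _-_; _─_; ⁅_⁆)
open import Data.Fin.Subset.Properties
  using (_∈?_; drop-∷-⊆; ⊆-antisym; p─q⊆p; x∈p∧x≢y⇒x∈p-y; x∈p⇒∣p-x∣<∣p∣; x∈⁅x⁆)
open import Data.List
  using (List; []; _∷_; [_]; length; map; concatMap; filter; lookup; allFin; upTo; _++_)
open import Data.List.Properties
  using (length-map; length-++; length-tabulate; upTo-∷ʳ; map-++; map-tabulate)
import Data.List as List
open import Data.List.Relation.Unary.Any using (here; there; index)
open import Data.List.Relation.Unary.Any.Properties using (lookup-index)
import Data.List.Relation.Unary.All as All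
open import Data.List.Relation.Unary.AllPairs using (_∷_)
open import Data.List.Relation.Unary.Unique.Propositional using (Unique)
open import Data.List.Relation.Unary.Unique.Propositional.Properties using (allFin⁺; filter⁺)
import Data.List.Membership.Propositional as L
open import Data.List.Membership.Propositional.Properties
  using (∈-lookup; ∈-map⁺; ∈-concat⁺′; ∈-++⁺ˡ; ∈-++⁺ʳ; ∈-filter⁺; ∈-filter⁻; ∈-allFin)
import Data.List.Membership.DecPropositional as DecMembership
open import Data.Vec using ([]; _∷_; tabulate; here; there)
open import Data.Vec.Properties using (lookup∘tabulate; lookup⇒[]=)
open import Data.Product using (_,_; proj₁; proj₂; ∃; ∃₂)
open import Data.Sum using (_⊎_; inj₁; inj₂)
open import Relation.Nullary using (¬_; yes; no; contradiction)
open import Relation.Binary using (Symmetric)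
open import Function using (_∘_)
open import Relation.Binary.PropositionalEquality
  using (refl; trans; cong; cong₂; subst; module ≡-Reasoning) renaming (sym to ≡-sym)

private
  variable
    A B : Set

lookup-injective : {xs : List A} → Unique xs → ∀ {i j} → lookup xs i ≡ lookup xs j → i ≡ j
lookup-injective {xs = x ∷ xs} _ {zero} {zero} _ = refl
lookup-injective {xs = x ∷ xs} (x∉xs ∷ _) {zero} {suc j} eq =
  contradiction eq (All.lookup x∉xs (∈-lookup j))
lookup-injective {xs = x ∷ xs} (x∉xs ∷ _) {suc i} {zero} eq =
  contradiction (≡-sym eq) (All.lookup x∉xs (∈-lookup i))
lookup-injective {xs = x ∷ xs} (_ ∷ u) {suc i} {suc j} eq = cong suc (lookup-injective u eq)

injectiveOn⇒length≤ : (g : A → B) {xs : List A} {ys : List B} → Unique xs →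
  (∀ {x y} → x L.∈ xs → y L.∈ xs → g x ≡ g y → x ≡ y) → (∀ {x} → x L.∈ xs → g x L.∈ ys) →
  length xs ≤ length ys
injectiveOn⇒length≤ g {xs} {ys} uxs g-inj g-into = injective⇒≤ {f = position} position-injective
  where
  position : Fin (length xs) → Fin (length ys)
  position i = index (g-into (∈-lookup i))
  position-injective : Injective _≡_ _≡_ position
  position-injective {i} {j} eq = lookup-injective uxs (g-inj (∈-lookup i) (∈-lookup j) (begin
    g (lookup xs i)         ≡⟨ lookup-index (g-into (∈-lookup i)) ⟩
    lookup ys (position i)  ≡⟨ cong (lookup ys) eq ⟩
    lookup ys (position j)  ≡⟨ lookup-index (g-into (∈-lookup j)) ⟨
    g (lookup xs j)         ∎))
    where open ≡-Reasoning

length<⇒∃∉ : ∀ {F} (cs : List (Fin F)) → length cs < F → ∃ λ c → c L.∉ cs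
length<⇒∃∉ {F} cs short = ¬∀⟶∃¬ F (L._∈ cs) (λ c → DecMembership._∈?_ _≟_ c cs) λ all∈cs →
  <⇒≱ short (subst (_≤ length cs) (length-tabulate {n = F} (λ c → c))
    (injectiveOn⇒length≤ (λ c → c) (allFin⁺ F) (λ _ _ eq → eq) (λ {c} _ → all∈cs c)))

length-concatMap-≤ : (f : A → List B) {b : ℕ} → (∀ x → length (f x) ≤ b) →
  ∀ xs → length (concatMap f xs) ≤ length xs * b
length-concatMap-≤ f bound [] = z≤n
length-concatMap-≤ f bound (x ∷ xs) = subst (_≤ _) (≡-sym (length-++ (f x)))
  (+-mono-≤ (bound x) (length-concatMap-≤ f bound xs))

predecessors : ∀ {t} → List (Fin (suc t)) → List (Fin t)
predecessors [] = []
predecessors (zero ∷ is) = predecessors is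
predecessors (suc i ∷ is) = i ∷ predecessors is

length-predecessors : ∀ {t} (is : List (Fin (suc t))) → length (predecessors is) ≤ length is
length-predecessors [] = z≤n
length-predecessors (zero ∷ is) = m≤n⇒m≤1+n (length-predecessors is)
length-predecessors (suc i ∷ is) = s≤s (length-predecessors is)

∈-predecessors : ∀ {t} {i : Fin t} {is} → suc i L.∈ is → i L.∈ predecessors is
∈-predecessors {is = suc _ ∷ _} (here refl) = here refl
∈-predecessors {is = zero ∷ _} (there i∈is) = ∈-predecessors i∈is
∈-predecessors {is = suc _ ∷ _} (there i∈is) = there (∈-predecessors i∈is)

greedy-colouring : ∀ {t F} (R : Fin t → Fin t → Set) → Symmetric R →
  (nbrs : Fin t → List (Fin t)) → (∀ i → length (nbrs i) < F) →
  (∀ {i j} → i ≢ j → R i j → j L.∈ nbrs i) →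
  Σ (Fin t → Fin F) λ c → ∀ {i j} → i ≢ j → R i j → c i ≢ c j
greedy-colouring {zero} R R-sym nbrs short covers = (λ ()) , λ {i} → contradiction i λ ()
greedy-colouring {suc t} {F} R R-sym nbrs short covers = colour , proper
  where
  rest : Σ (Fin t → Fin F) λ c → ∀ {i j} → i ≢ j → R (suc i) (suc j) → c i ≢ c j
  rest = greedy-colouring (λ i j → R (suc i) (suc j)) R-sym (predecessors ∘ nbrs ∘ suc)
    (λ i → ≤-<-trans (length-predecessors (nbrs (suc i))) (short (suc i)))
    (λ i≢j r → ∈-predecessors (covers (i≢j ∘ suc-injective) r))
  used : List (Fin F)
  used = map (proj₁ rest) (predecessors (nbrs zero))
  free : ∃ λ c → c L.∉ used
  free = length<⇒∃∉ used (subst (_< F) (≡-sym (length-map (proj₁ rest) (predecessors (nbrs zero))))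
    (≤-<-trans (length-predecessors (nbrs zero)) (short zero)))
  colour : Fin (suc t) → Fin F
  colour zero = proj₁ free
  colour (suc i) = proj₁ rest i
  proper-zero : ∀ {j} → zero ≢ suc j → R zero (suc j) → colour zero ≢ colour (suc j)
  proper-zero 0≢j r eq = proj₂ free (subst (L._∈ used) (≡-sym eq) (∈-map⁺ _ (∈-predecessors (covers 0≢j r))))
  proper : ∀ {i j} → i ≢ j → R i j → colour i ≢ colour j
  proper {zero} {zero} i≢j _ = contradiction refl i≢j
  proper {zero} {suc j} i≢j r = proper-zero i≢j r
  proper {suc i} {zero} i≢j r = proper-zero (i≢j ∘ ≡-sym) (R-sym r) ∘ ≡-sym
  proper {suc i} {suc j} i≢j r = proj₂ rest (i≢j ∘ cong suc) r

binomialSum : ℕ → ℕ → ℕ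
binomialSum d k = sum (map (d C_) (upTo k))

binomialSum-suc : ∀ d k → binomialSum d (suc k) ≡ binomialSum d k + d C k
binomialSum-suc d k = begin
  sum (map (d C_) (upTo (suc k)))            ≡⟨ cong (sum ∘ map (d C_)) (upTo-∷ʳ k) ⟨
  sum (map (d C_) (upTo k ++ [ k ]))         ≡⟨ cong sum (map-++ (d C_) (upTo k) [ k ]) ⟩
  sum (map (d C_) (upTo k) ++ [ d C k ])     ≡⟨ sum-++ (map (d C_) (upTo k)) [ d C k ] ⟩
  binomialSum d k + (d C k + 0)              ≡⟨ cong (binomialSum d k +_) (+-identityʳ (d C k)) ⟩
  binomialSum d k + d C k                    ∎
  where open ≡-Reasoning

binomialSum-pascal : ∀ d k → binomialSum (suc d) (suc k) ≡ binomialSum d (suc k) + binomialSum d k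
binomialSum-pascal d zero = refl
binomialSum-pascal d (suc k) = begin
  binomialSum (suc d) (suc (suc k))
    ≡⟨ binomialSum-suc (suc d) (suc k) ⟩
  binomialSum (suc d) (suc k) + suc d C suc k
    ≡⟨ cong₂ _+_ (binomialSum-pascal d k) (≡-sym (nCk+nC[k+1]≡[n+1]C[k+1] d k)) ⟩
  (binomialSum d (suc k) + binomialSum d k) + (d C k + d C suc k)
    ≡⟨ shuffle (binomialSum d (suc k)) (binomialSum d k) (d C k) (d C suc k) ⟩
  (binomialSum d (suc k) + d C suc k) + (binomialSum d k + d C k)
    ≡⟨ cong₂ _+_ (binomialSum-suc d (suc k)) (binomialSum-suc d k) ⟨
  binomialSum d (suc (suc k)) + binomialSum d (suc k)
    ∎
  where
  open ≡-Reasoning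
  open +-*-Solver using (solve; _:+_; _:=_)
  shuffle : ∀ a b c e → (a + b) + (c + e) ≡ (a + e) + (b + c)
  shuffle = solve 4 (λ a b c e → (a :+ b) :+ (c :+ e) := (a :+ e) :+ (b :+ c)) refl

binomialSum-0-suc : ∀ k → binomialSum 0 (suc k) ≡ 1
binomialSum-0-suc zero = refl
binomialSum-0-suc (suc k) = trans (binomialSum-suc 0 (suc k)) (cong (_+ 0) (binomialSum-0-suc k))

binomialSum-monoˡ-≤ : ∀ {d e} k → d ≤ e → binomialSum d k ≤ binomialSum e k
binomialSum-monoˡ-≤ k d≤e = go (≤⇒≤′ d≤e)
  where
  step : ∀ d k → binomialSum d k ≤ binomialSum (suc d) k
  step d zero = z≤n
  step d (suc k) = subst (binomialSum d (suc k) ≤_) (≡-sym (binomialSum-pascal d k))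
    (m≤m+n (binomialSum d (suc k)) (binomialSum d k))
  go : ∀ {d e} → d ≤′ e → binomialSum d k ≤ binomialSum e k
  go ≤′-refl = ≤-refl
  go (≤′-step d≤′e) = ≤-trans (go d≤′e) (step _ k)

smallSubsets : ∀ {m} → Subset m → ℕ → List (Subset m)
smallSubsets [] zero = []
smallSubsets [] (suc k) = [ [] ]
smallSubsets (outside ∷ P) k = map (outside ∷_) (smallSubsets P k)
smallSubsets (inside ∷ P) zero = []
smallSubsets (inside ∷ P) (suc k) =
  map (outside ∷_) (smallSubsets P (suc k)) ++ map (inside ∷_) (smallSubsets P k)

length-smallSubsets : ∀ {m} (P : Subset m) k → length (smallSubsets P k) ≡ binomialSum ∣ P ∣ k
length-smallSubsets [] zero = refl
length-smallSubsets [] (suc k) = ≡-sym (binomialSum-0-suc k)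
length-smallSubsets (outside ∷ P) k = trans (length-map (outside ∷_) (smallSubsets P k)) (length-smallSubsets P k)
length-smallSubsets (inside ∷ P) zero = refl
length-smallSubsets (inside ∷ P) (suc k) = begin
  length (map (outside ∷_) (smallSubsets P (suc k)) ++ map (inside ∷_) (smallSubsets P k))
    ≡⟨ length-++ (map (outside ∷_) (smallSubsets P (suc k))) ⟩
  length (map (outside ∷_) (smallSubsets P (suc k))) + length (map (inside ∷_) (smallSubsets P k))
    ≡⟨ cong₂ _+_ (length-map (outside ∷_) (smallSubsets P (suc k))) (length-map (inside ∷_) (smallSubsets P k)) ⟩
  length (smallSubsets P (suc k)) + length (smallSubsets P k)
    ≡⟨ cong₂ _+_ (length-smallSubsets P (suc k)) (length-smallSubsets P k) ⟩
  binomialSum (∣ P ∣) (suc k) + binomialSum (∣ P ∣) k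
    ≡⟨ binomialSum-pascal ∣ P ∣ k ⟨
  binomialSum (suc ∣ P ∣) (suc k)
    ∎
  where open ≡-Reasoning

∈-smallSubsets : ∀ {m} {X P : Subset m} {k} → X ⊆ P → ∣ X ∣ < k → X L.∈ smallSubsets P k
∈-smallSubsets {X = []} {[]} {suc k} _ _ = here refl
∈-smallSubsets {X = outside ∷ X} {outside ∷ P} X⊆P small = ∈-map⁺ (outside ∷_) (∈-smallSubsets (drop-∷-⊆ X⊆P) small)
∈-smallSubsets {X = inside ∷ X} {outside ∷ P} X⊆P _ with X⊆P here
... | ()
∈-smallSubsets {X = outside ∷ X} {inside ∷ P} {suc k} X⊆P small =
  ∈-++⁺ˡ (∈-map⁺ (outside ∷_) (∈-smallSubsets (drop-∷-⊆ X⊆P) small))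
∈-smallSubsets {X = inside ∷ X} {inside ∷ P} {suc k} X⊆P (s≤s small) =
  ∈-++⁺ʳ (map (outside ∷_) (smallSubsets P (suc k))) (∈-map⁺ (inside ∷_) (∈-smallSubsets (drop-∷-⊆ X⊆P) small))

members : ∀ {m} → Subset m → List (Fin m)
members [] = []
members (outside ∷ P) = map suc (members P)
members (inside ∷ P) = zero ∷ map suc (members P)

length-members : ∀ {m} (P : Subset m) → length (members P) ≡ ∣ P ∣
length-members [] = refl
length-members (outside ∷ P) = trans (length-map suc (members P)) (length-members P)
length-members (inside ∷ P) = cong suc (trans (length-map suc (members P)) (length-members P))

∈-members : ∀ {m} {x : Fin m} {P} → x ∈ P → x L.∈ members P
∈-members here = here refl
∈-members {P = outside ∷ P} (there x∈P) = ∈-map⁺ suc (∈-members x∈P)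
∈-members {P = inside ∷ P} (there x∈P) = there (∈-map⁺ suc (∈-members x∈P))

x∈p-y⇒x≢y : ∀ {m} {x y : Fin m} {P} → x ∈ P - y → x ≢ y
x∈p-y⇒x≢y {x = x} {P = P} x∈P-y refl = go P ⁅ x ⁆ x∈P-y (x∈⁅x⁆ x)
  where
  go : ∀ {m} {x : Fin m} (P Q : Subset m) → x ∈ P ─ Q → x ∉ Q
  go (_ ∷ P) (outside ∷ Q) here ()
  go (_ ∷ P) (_ ∷ Q) (there x∈P─Q) (there x∈Q) = go P Q x∈P─Q x∈Q

p-x≡q-x⇒p≡q : ∀ {m} {x : Fin m} {P Q} → x ∈ P → x ∈ Q → P - x ≡ Q - x → P ≡ Q
p-x≡q-x⇒p≡q {x = x} {P} {Q} x∈P x∈Q eq = ⊆-antisym (included x∈Q eq) (included x∈P (≡-sym eq))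
  where
  included : ∀ {P Q} → x ∈ Q → P - x ≡ Q - x → P ⊆ Q
  included {P} {Q} x∈Q eq {y} y∈P with y ≟ x
  ... | yes refl = x∈Q
  ... | no y≢x = p─q⊆p Q ⁅ x ⁆ (subst (y ∈_) eq (x∈p∧x≢y⇒x∈p-y y∈P y≢x))

∣tabulate∣ : ∀ {m} (p : Fin m → Bool) →
  ∣ tabulate p ∣ ≡ sum (map (λ v → if p v then 1 else 0) (allFin m))
∣tabulate∣ p = trans (count-tabulate p)
  (cong sum (≡-sym (map-tabulate (λ v → v) (λ v → if p v then 1 else 0))))
  where
  count-tabulate : ∀ {m} (p : Fin m → Bool) →
    ∣ tabulate p ∣ ≡ sum (List.tabulate (λ v → if p v then 1 else 0))
  count-tabulate {zero} p = refl
  count-tabulate {suc m} p with p zero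
  ... | true = cong suc (count-tabulate (p ∘ suc))
  ... | false = count-tabulate (p ∘ suc)

module _ (G : Graph) where

  neighbourhood : Fin (n G) → Subset (n G)
  neighbourhood u = tabulate (adj G u)

  ∣neighbourhood∣≡degree : ∀ u → ∣ neighbourhood u ∣ ≡ degree G u
  ∣neighbourhood∣≡degree u = ∣tabulate∣ (adj G u)

  adj⇒∈neighbourhood : ∀ {u v} → adj G u v ≡ true → v ∈ neighbourhood u
  adj⇒∈neighbourhood {u} {v} uv = lookup⇒[]= v (neighbourhood u) (trans (lookup∘tabulate (adj G u) v) uv)

  closedNeighbourhood : Subset (n G) → List (Fin (n G))
  closedNeighbourhood X = concatMap (λ u → u ∷ members (neighbourhood u)) (members X)

  ∈-closedNeighbourhood : ∀ {X u v} → u ∈ X → u ≡ v ⊎ adj G u v ≡ true → v L.∈ closedNeighbourhood X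
  ∈-closedNeighbourhood {u = u} u∈X u~v =
    ∈-concat⁺′ (v∈N[u] u~v) (∈-map⁺ (λ u → u ∷ members (neighbourhood u)) (∈-members u∈X))
    where
    v∈N[u] : ∀ {v} → u ≡ v ⊎ adj G u v ≡ true → v L.∈ u ∷ members (neighbourhood u)
    v∈N[u] (inj₁ refl) = here refl
    v∈N[u] (inj₂ uv) = there (∈-members (adj⇒∈neighbourhood uv))

  length-closedNeighbourhood : ∀ {δ} → (∀ u → degree G u ≤ δ) →
    ∀ X → length (closedNeighbourhood X) ≤ ∣ X ∣ * suc δ
  length-closedNeighbourhood {δ} bounded X = begin
    length (closedNeighbourhood X)  ≤⟨ length-concatMap-≤ (λ u → u ∷ members (neighbourhood u)) closed (members X) ⟩
    length (members X) * suc δ      ≡⟨ cong (_* suc δ) (length-members X) ⟩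
    ∣ X ∣ * suc δ                   ∎
    where
    open ≤-Reasoning
    closed : ∀ u → length (u ∷ members (neighbourhood u)) ≤ suc δ
    closed u = s≤s (subst (_≤ δ)
      (≡-sym (trans (length-members (neighbourhood u)) (∣neighbourhood∣≡degree u))) (bounded u))

  Touch : Subset (n G) → Subset (n G) → Set
  Touch X Y = ∃₂ λ u v → u ∈ X × v ∈ Y × (u ≡ v ⊎ adj G u v ≡ true)

  Touch-sym : Symmetric Touch
  Touch-sym (u , v , u∈X , v∈Y , inj₁ u≡v) = v , u , v∈Y , u∈X , inj₁ (≡-sym u≡v)
  Touch-sym (u , v , u∈X , v∈Y , inj₂ uv) = v , u , v∈Y , u∈X , inj₂ (trans (sym G v u) uv)

  ¬Touch⇒Anticomplete : ∀ {X Y} → ¬ Touch X Y → Anticomplete G X Y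
  ¬Touch⇒Anticomplete apart u v u∈X v∈Y = (λ u≡v → apart (u , v , u∈X , v∈Y , inj₁ u≡v)) , non-adjacent
    where
    non-adjacent : adj G u v ≡ false
    non-adjacent with adj G u v in uv
    ... | true = contradiction (u , v , u∈X , v∈Y , inj₂ uv) apart
    ... | false = refl

module CliqueConflicts (G : Graph) {δ} (bounded : ∀ u → degree G u ≤ δ)
  {t} (K : Fin t → Subset (n G)) (K-injective : Injective _≡_ _≡_ K)
  (K-clique : ∀ i → IsClique G (K i)) {k} (K-size : ∀ i → ∣ K i ∣ ≤ k) where

  cliquesAt : Fin (n G) → List (Fin t)
  cliquesAt w = filter (λ j → w ∈? K j) (allFin t)

  length-cliquesAt : ∀ w → length (cliquesAt w) ≤ binomialSum δ k
  length-cliquesAt w = begin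
    length (cliquesAt w)
      ≤⟨ injectiveOn⇒length≤ (λ j → K j - w) (filter⁺ (λ j → w ∈? K j) (allFin⁺ t))
           remove-injective remove-small ⟩
    length (smallSubsets (neighbourhood G w) k)
      ≡⟨ length-smallSubsets (neighbourhood G w) k ⟩
    binomialSum (∣ neighbourhood G w ∣) k
      ≡⟨ cong (λ d → binomialSum d k) (∣neighbourhood∣≡degree G w) ⟩
    binomialSum (degree G w) k
      ≤⟨ binomialSum-monoˡ-≤ k (bounded w) ⟩
    binomialSum δ k
      ∎
    where
    open ≤-Reasoning
    w∈K : ∀ {j} → j L.∈ cliquesAt w → w ∈ K j
    w∈K j∈ = proj₂ (∈-filter⁻ (λ j → w ∈? K j) {xs = allFin t} j∈)
    remove-injective : ∀ {i j} → i L.∈ cliquesAt w → j L.∈ cliquesAt w → K i - w ≡ K j - w → i ≡ j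
    remove-injective i∈ j∈ eq = K-injective (p-x≡q-x⇒p≡q (w∈K i∈) (w∈K j∈) eq)
    remove-small : ∀ {j} → j L.∈ cliquesAt w → K j - w L.∈ smallSubsets (neighbourhood G w) k
    remove-small {j} j∈ = ∈-smallSubsets
      (λ v∈ → adj⇒∈neighbourhood G
        (K-clique j w _ (w∈K j∈) (p─q⊆p (K j) ⁅ w ⁆ v∈) (x∈p-y⇒x≢y v∈ ∘ ≡-sym)))
      (<-≤-trans (x∈p⇒∣p-x∣<∣p∣ (w∈K j∈)) (K-size j))

  conflicts : Fin t → List (Fin t)
  conflicts i = concatMap cliquesAt (closedNeighbourhood G (K i))

  Touch⇒∈conflicts : ∀ {i j} → i ≢ j → Touch G (K i) (K j) → j L.∈ conflicts i
  Touch⇒∈conflicts _ (u , v , u∈Ki , v∈Kj , u~v) = ∈-concat⁺′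
    (∈-filter⁺ (λ j → v ∈? K j) (∈-allFin _) v∈Kj) (∈-map⁺ cliquesAt (∈-closedNeighbourhood G u∈Ki u~v))

  length-conflicts : ∀ i → length (conflicts i) ≤ (k + δ * k) * binomialSum δ k
  length-conflicts i = begin
    length (conflicts i)
      ≤⟨ length-concatMap-≤ cliquesAt length-cliquesAt (closedNeighbourhood G (K i)) ⟩
    length (closedNeighbourhood G (K i)) * binomialSum δ k
      ≤⟨ *-monoˡ-≤ (binomialSum δ k) (length-closedNeighbourhood G bounded (K i)) ⟩
    (∣ K i ∣ * suc δ) * binomialSum δ k
      ≤⟨ *-monoˡ-≤ (binomialSum δ k) (*-monoˡ-≤ (suc δ) (K-size i)) ⟩
    (k * suc δ) * binomialSum δ k
      ≡⟨ cong (_* binomialSum δ k) (trans (*-suc k δ) (cong (k +_) (*-comm k δ))) ⟩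
    (k + δ * k) * binomialSum δ k
      ∎
    where open ≤-Reasoning

lemma4p2 : (δ k : ℕ) → 0 < k → k ≤ δ →
    (G : Graph) → MaxDegree G δ →
    (t : ℕ) (K : Fin t → Subset (n G)) → Injective _≡_ _≡_ K →
    (∀ i → IsClique G (K i)) → (∀ i → ∣ K i ∣ ≤ k) →
    Σ (Fin t → Fin (f k δ)) λ part →
    ∀ i j → i ≢ j → part i ≡ part j → Anticomplete G (K i) (K j)
lemma4p2 δ k _ _ G (bounded , _) t K K-injective K-clique K-size =
  proj₁ colouring , λ i j i≢j same → ¬Touch⇒Anticomplete G λ touch → proj₂ colouring i≢j touch same
  where
  open CliqueConflicts G bounded K K-injective K-clique K-size
  colouring : Σ (Fin t → Fin (f k δ)) λ c → ∀ {i j} → i ≢ j → Touch G (K i) (K j) → c i ≢ c j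
  colouring = greedy-colouring (λ i j → Touch G (K i) (K j)) (Touch-sym G) conflicts
    (λ i → ≤-<-trans (length-conflicts i) (m<m+n _ z<s)) Touch⇒∈conflicts
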